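{- Let $V$ be a finite set with a topology $\mathcal D$, for each $v\in V$ let $\Omega_v$ be a nonempty preordered set, and let $\Theta$ be the presheaf of relative traces. Let $(A,\mathcal U)$ be a specification, i.e. $A\subseteq\Theta$ is a subpresheaf and $\mathcal U$ is a maximal cover of $(V,\mathcal D)$. If $A$ is flasque beneath the cover $\mathcal U$ — that is, for all $W\subseteq W'$ in $\mathcal D$ with $W'\subseteq U$ for some $U\in\mathcal U$, the restriction map $AW'\to AW$ is surjective — then $(A,\mathcal U)$ is locally consistent: for all $U,W\in\mathcal U$, $$\{x|_{U\cap W}: x\in AU\}=\{y|_{U\cap W}: y\in AW\}.$$
   Context: For $U\in\mathcal D$, $\Omega U\defeq\prod_{v\in U}\Omega_v$ with the componentwise preorder. For $n\ge -1$, a $U$-trace of length $n$ is a sequence $x_0\le\dots\le x_n$ of elements of $\Omega U$ (empty when $n=-1$) with $x_i\ne x_{i+1}$ for all $0\le i<n$; $\Theta U$ is the set of all $U$-traces. For $U\subseteq U'$ and $x\in\Theta U'$, $x|_U\in\Theta U$ is obtained by projecting each $x_i$ onto the coordinates in $U$ and collapsing every maximal run of consecutive equal entries to one entry; this makes $\Theta$ a presheaf on $\mathcal D$. A subpresheaf $A\subseteq\Theta$ is a choice of subsets $AU\subseteq\Theta U$ for each $U\in\mathcal D$ closed under restriction ($x\in AU'$, $U\subseteq U'$ implies $x|_U\in AU$). A maximal cover of $(V,\mathcal D)$ is a family of open sets whose union is $V$ and which is an antichain under inclusion. -}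

module Defs where

open import Data.Nat using (ℕ; zero; suc)
open import Data.Bool using (Bool; true; false)
open import Data.Fin using (Fin; zero; suc)
open import Data.Fin.Subset using (Subset; _∈_; _⊆_; _∩_; _∪_; ⊥; ⊤)
open import Data.Vec using ([]; _∷_)
open import Data.List using (List; []; _∷_; [_])
open import Data.List.Relation.Unary.Linked using (Linked)
open import Data.List.Relation.Binary.Pointwise using (Pointwise)
open import Data.Product using (Σ; _×_; _,_; ∃)
open import Data.Unit using () renaming (⊤ to Unit)
open import Relation.Binary.PropositionalEquality using (_≡_; _≢_)
open import Data.Vec using (_[_]=_; here; there)
open import Function using (_∘_)

-- ΩU = ∏_{v ∈ U} Ω_v, as a canonical iterated product (so that ≡ is the
-- correct equality of tuples).
OmegaS : ∀ {n} (Ω : Fin n → Set) → Subset n → Set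
OmegaS {zero}  Ω []          = Unit
OmegaS {suc n} Ω (true ∷ U)  = Ω zero × OmegaS (Ω ∘ suc) U
OmegaS {suc n} Ω (false ∷ U) = OmegaS (Ω ∘ suc) U

get : ∀ {n} {Ω : Fin n → Set} (U : Subset n) → OmegaS Ω U → (v : Fin n) → v ∈ U → Ω v
get (true ∷ U)  (a , r) zero    here      = a
get (true ∷ U)  (a , r) (suc v) (there p) = get U r v p
get (false ∷ U) r       (suc v) (there p) = get U r v p

_≤[_]_ : ∀ {n} {Ω : Fin n → Set} {U : Subset n} →
         OmegaS Ω U → ((v : Fin n) → Ω v → Ω v → Set) → OmegaS Ω U → Set
_≤[_]_ {U = U} x R y = ∀ v (p : v ∈ U) → R v (get U x v p) (get U y v p)

-- a U-trace: x₀ ≤ … ≤ xₙ with consecutive entries distinct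
-- (the empty list is the trace of length -1)
IsTrace : ∀ {n} (Ω : Fin n → Set) (R : (v : Fin n) → Ω v → Ω v → Set)
          (U : Subset n) → List (OmegaS Ω U) → Set
IsTrace Ω R U = Linked (λ a b → (a ≤[ R ] b) × a ≢ b)

Proj : ∀ {n} {Ω : Fin n → Set} (U U' : Subset n) → OmegaS Ω U' → OmegaS Ω U → Set
Proj U U' a b = ∀ v (p : v ∈ U) (p' : v ∈ U') → get U b v p ≡ get U' a v p'

data Collapse {A : Set} : List A → List A → Set where
  c[]  : Collapse [] []
  c1   : ∀ a → Collapse [ a ] [ a ]
  cEq  : ∀ a rest r → Collapse (a ∷ rest) r → Collapse (a ∷ a ∷ rest) r
  cNeq : ∀ a b rest r → a ≢ b → Collapse (b ∷ rest) r → Collapse (a ∷ b ∷ rest) (a ∷ r)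

Res : ∀ {n} (Ω : Fin n → Set) (U U' : Subset n) →
      List (OmegaS Ω U') → List (OmegaS Ω U) → Set
Res Ω U U' x y = Σ (List (OmegaS Ω U)) λ z → Pointwise (λ a b → Proj U U' a b) x z × Collapse z y

record IsTopology {n : ℕ} (D : Subset n → Set) : Set where
  field
    empty-open : D ⊥
    full-open  : D ⊤
    ∩-open     : ∀ {U W} → D U → D W → D (U ∩ W)
    ∪-open     : ∀ {U W} → D U → D W → D (U ∪ W)

record IsSubpresheaf {n : ℕ} (Ω : Fin n → Set) (R : (v : Fin n) → Ω v → Ω v → Set)
       (D : Subset n → Set) (A : (U : Subset n) → List (OmegaS Ω U) → Set) : Set where
  field
    traces  : ∀ {U} → D U → ∀ x → A U x → IsTrace Ω R U x
    closed  : ∀ {U U'} → D U → D U' → U ⊆ U' →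
              ∀ x y → A U' x → Res Ω U U' x y → A U y

record IsMaximalCover {n : ℕ} (D : Subset n → Set) (C : Subset n → Set) : Set where
  field
    opens     : ∀ {U} → C U → D U
    covers    : ∀ (v : Fin n) → ∃ λ U → C U × v ∈ U
    antichain : ∀ {U W} → C U → C W → U ⊆ W → U ≡ W

FlasqueBeneath : ∀ {n} (Ω : Fin n → Set) (D : Subset n → Set)
                 (A : (U : Subset n) → List (OmegaS Ω U) → Set) (C : Subset n → Set) → Set
FlasqueBeneath {n} Ω D A C =
  ∀ {W W' : Subset n} → D W → D W' → W ⊆ W' → (∃ λ U → C U × W' ⊆ U) →
  ∀ y → A W y → ∃ λ x → A W' x × Res Ω W W' x y

LocallyConsistent : ∀ {n} (Ω : Fin n → Set)
                    (A : (U : Subset n) → List (OmegaS Ω U) → Set) (C : Subset n → Set) → Set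
LocallyConsistent {n} Ω A C =
  ∀ {U W : Subset n} → C U → C W →
    (∀ x z → A U x → Res Ω (U ∩ W) U x z → ∃ λ y → A W y × Res Ω (U ∩ W) W y z)
  × (∀ y z → A W y → Res Ω (U ∩ W) W y z → ∃ λ x → A U x × Res Ω (U ∩ W) U x z)

{-# OPTIONS --safe #-}
-- A restriction of a trace in A U to U ∩ W is, since A is a subpresheaf, a
-- trace in A (U ∩ W); as W is itself a member of the cover, flasqueness
-- beneath the cover lifts it to a trace in A W. The same argument runs with
-- U and W exchanged.
module Submission where

open import Defs
open import Data.Nat using (ℕ)
open import Data.Fin using (Fin)
open import Data.Fin.Subset using (Subset; _⊆_; _∩_)
open import Data.Fin.Subset.Properties using (p∩q⊆p; p∩q⊆q; ⊆-refl)
open import Data.List using (List)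
open import Data.Product using (∃; _×_; _,_)

module _ {n : ℕ} {Ω : Fin n → Set} {R : (v : Fin n) → Ω v → Ω v → Set}
         {D : Subset n → Set} {A : (U : Subset n) → List (OmegaS Ω U) → Set}
         {C : Subset n → Set}
         (S : IsSubpresheaf Ω R D A) (F : FlasqueBeneath Ω D A C) where

  open IsSubpresheaf S

  restriction-transfer : ∀ {K U W} → D K → D U → D W → K ⊆ U → K ⊆ W →
    (∃ λ U′ → C U′ × W ⊆ U′) →
    ∀ x z → A U x → Res Ω K U x z → ∃ λ y → A W y × Res Ω K W y z
  restriction-transfer dK dU dW K⊆U K⊆W W-beneath x z ax x↾z =
    F dK dW K⊆W W-beneath z (closed dK dU K⊆U x z ax x↾z)

theorem5 : (n : ℕ) (Ω : Fin n → Set) (R : (v : Fin n) → Ω v → Ω v → Set)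
    → (∀ v (a : Ω v) → R v a a)
    → (∀ v (a b c : Ω v) → R v a b → R v b c → R v a c)
    → ((v : Fin n) → Ω v)
    → (D : Subset n → Set) → IsTopology D
    → (A : (U : Subset n) → List (OmegaS Ω U) → Set) → IsSubpresheaf Ω R D A
    → (C : Subset n → Set) → IsMaximalCover D C
    → FlasqueBeneath Ω D A C
    → LocallyConsistent Ω A C
theorem5 n Ω R _ _ _ D T A S C M F {U} {W} cU cW =
    restriction-transfer S F dU∩W dU dW (p∩q⊆p U W) (p∩q⊆q U W) (W , cW , ⊆-refl)
  , restriction-transfer S F dU∩W dW dU (p∩q⊆q U W) (p∩q⊆p U W) (U , cU , ⊆-refl)
  where
  open IsTopology T
  open IsMaximalCover M
  dU : D U
  dU = opens cU
  dW : D W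
  dW = opens cW
  dU∩W : D (U ∩ W)
  dU∩W = ∩-open dU dW
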